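{- Consider a sequence of operations applied to a token placement on a connected graph $G$, where each operation is either a happy swap chain or an unhappy swap. Let $T_i$ be a token located on its target vertex $i$ that participates in an unhappy swap of this sequence. Then the next swap in the sequence that involves $T_i$ (if any) is a happy swap, i.e., a swap that is part of a happy swap chain.
   Context: Token swapping setting: each vertex of $G$ holds exactly one token, each token has a target vertex (targets form a bijection between tokens and vertices; token $T_i$ has target vertex $i$), and a swap exchanges the tokens on the two endpoints of an edge. Distances are graph distances in $G$. An unhappy swap is a swap along an edge where one of the two swapped tokens is already on its target vertex and the other token reduces its distance to its target vertex by one. A happy swap chain of length $\ell\ge 1$: take a path of $\ell+1$ distinct vertices $v_1,\dots,v_{\ell+1}$ and swap along $(v_1,v_2),(v_2,v_3),\dots,(v_\ell,v_{\ell+1})$ in this order, so the token from $v_1$ ends on $v_{\ell+1}$ and the token from each $v_j$ ($j\ge 2$) ends on $v_{j-1}$; it is a happy swap chain if every moved token ends strictly closer (by at least $1$) to its target than before. A happy swap is a single swap that is part of a happy swap chain. -}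

module Defs where

open import Data.Nat using (ℕ; zero; suc; _≤_; _<_)
open import Data.Fin using (Fin; _≟_; toℕ)
open import Data.List using (List; []; _∷_; length; map; take; foldl; _++_; lookup)
open import Data.List.Relation.Unary.All using (All)
open import Data.List.Relation.Unary.Any using (Any)
open import Data.List.Membership.Propositional using (_∈_)
open import Data.List.Relation.Unary.Unique.Propositional using (Unique)
open import Data.Product using (_×_; _,_; ∃)
open import Data.Sum using (_⊎_)
open import Data.Unit using (⊤)
open import Data.Bool using (if_then_else_)
open import Relation.Nullary using (¬_; does)
open import Relation.Binary.PropositionalEquality using (_≡_)

record Graph (n : ℕ) : Set₁ where
  field
    Adj    : Fin n → Fin n → Set
    sym    : ∀ {u v} → Adj u v → Adj v u
    irrefl : ∀ {u} → ¬ Adj u u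
open Graph public

data Walk {n : ℕ} (G : Graph n) : Fin n → Fin n → ℕ → Set where
  here : ∀ {u} → Walk G u u 0
  step : ∀ {u w v k} → Adj G u w → Walk G w v k → Walk G u v (suc k)

Connected : ∀ {n} → Graph n → Set
Connected G = ∀ u v → ∃ λ k → Walk G u v k

Dist : ∀ {n} → Graph n → Fin n → Fin n → ℕ → Set
Dist G u v d = Walk G u v d × (∀ k → Walk G u v k → d ≤ k)

-- Token placements: vertex ↦ token on it.  Tokens are named by their
-- target vertex (token T_i has target i), so a token t sits on its
-- target at vertex v iff σ v ≡ t ≡ v.

Placement : ℕ → Set
Placement n = Fin n → Fin n

OnTarget : ∀ {n} → Placement n → Fin n → Set
OnTarget σ v = σ v ≡ v

swapAt : ∀ {n} → Placement n → Fin n → Fin n → Placement n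
swapAt σ a b x = if does (x ≟ a) then σ b else (if does (x ≟ b) then σ a else σ x)

StrictlyCloser : ∀ {n} → Graph n → Fin n → Fin n → Fin n → Set
StrictlyCloser G t x y = ∀ d d′ → Dist G x t d → Dist G y t d′ → d′ < d

ReducesByOne : ∀ {n} → Graph n → Fin n → Fin n → Fin n → Set
ReducesByOne G t x y = ∀ d d′ → Dist G x t d → Dist G y t d′ → d ≡ suc d′

edgesOf : ∀ {A : Set} → List A → List (A × A)
edgesOf []            = []
edgesOf (x ∷ [])      = []
edgesOf (x ∷ y ∷ xs)  = (x , y) ∷ edgesOf (y ∷ xs)

applyEdges : ∀ {n} → Placement n → List (Fin n × Fin n) → Placement n
applyEdges σ es = foldl (λ τ e → swapAt τ (Data.Product.proj₁ e) (Data.Product.proj₂ e)) σ es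

data Op (n : ℕ) : Set where
  chain   : List (Fin n) → Op n
  unhappy : Fin n → Fin n → Op n

HappyChain : ∀ {n} → Graph n → Placement n → List (Fin n) → Set
HappyChain G σ p =
  2 ≤ length p × Unique p × All (λ e → Adj G (Data.Product.proj₁ e) (Data.Product.proj₂ e)) (edgesOf p)
  × (∀ x y → x ∈ p → applyEdges σ (edgesOf p) y ≡ σ x → StrictlyCloser G (σ x) x y)

UnhappySwap : ∀ {n} → Graph n → Placement n → Fin n → Fin n → Set
UnhappySwap G σ u v =
  Adj G u v × ((OnTarget σ u × ReducesByOne G (σ v) v u)
             ⊎ (OnTarget σ v × ReducesByOne G (σ u) u v))

ValidOp : ∀ {n} → Graph n → Placement n → Op n → Set
ValidOp G σ (chain p)     = HappyChain G σ p
ValidOp G σ (unhappy u v) = UnhappySwap G σ u v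

applyOp : ∀ {n} → Placement n → Op n → Placement n
applyOp σ (chain p)     = applyEdges σ (edgesOf p)
applyOp σ (unhappy u v) = swapAt σ u v

ValidSeq : ∀ {n} → Graph n → Placement n → List (Op n) → Set
ValidSeq G σ []         = ⊤
ValidSeq G σ (o ∷ os)   = ValidOp G σ o × ValidSeq G (applyOp σ o) os

data Kind : Set where
  happy unhappy : Kind

record LSwap (n : ℕ) : Set where
  constructor lswap
  field
    kind : Kind
    fst  : Fin n
    snd  : Fin n
open LSwap public

opSwaps : ∀ {n} → Op n → List (LSwap n)
opSwaps (chain p)     = map (λ e → lswap happy (Data.Product.proj₁ e) (Data.Product.proj₂ e)) (edgesOf p)
opSwaps (unhappy u v) = lswap unhappy u v ∷ []

flatten : ∀ {n} → List (Op n) → List (LSwap n)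
flatten []       = []
flatten (o ∷ os) = opSwaps o ++ flatten os

applyLSwaps : ∀ {n} → Placement n → List (LSwap n) → Placement n
applyLSwaps σ ss = foldl (λ τ s → swapAt τ (fst s) (snd s)) σ ss

-- placement just before the k-th swap (0-based) of the swap list ss
before : ∀ {n} → Placement n → (ss : List (LSwap n)) → ℕ → Placement n
before σ ss k = applyLSwaps σ (take k ss)

InvolvesToken : ∀ {n} → Placement n → LSwap n → Fin n → Set
InvolvesToken τ s t = τ (fst s) ≡ t ⊎ τ (snd s) ≡ t

module Submission where

-- A token on its target that takes part in an unhappy swap is moved to a neighbour w of its
-- target, and stays on w until it is touched again.  An unhappy swap cannot touch a token at
-- distance 1 from its target: that token is not on its own target, and if it is the one that
-- approaches, it arrives at its target — which the partner token, sitting on its own target,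
-- already occupies.

open import Defs hiding (sym)
open import Data.Nat using (ℕ; zero; suc; _<_; _≤_; _≤′_; ≤′-refl; ≤′-step; z≤n; s≤s)
open import Data.Nat.Properties using (≤⇒≤′; ≤′⇒≤; <⇒≤; ≤-refl; m<n⇒m<1+n)
open import Data.Fin using (Fin; toℕ; _≟_; fromℕ<)
import Data.Fin as Fin
open import Data.Fin.Properties using (toℕ<n; toℕ-fromℕ<)
open import Data.Fin.Permutation.Components using (transpose; transpose-inverse)
open import Data.List using (List; []; _∷_; length; lookup; _++_; map; take)
open import Data.List.Relation.Unary.All using (All; []; _∷_)
open import Data.Product using (_×_; _,_; ∃₂; Σ-syntax; proj₁; proj₂)
open import Data.Sum using (_⊎_; inj₁; inj₂)
open import Data.Empty using (⊥-elim)
open import Function using (_∘_)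
open import Function.Definitions using (Bijective; Injective)
open import Relation.Nullary using (¬_; yes; no)
open import Relation.Nullary.Decidable using (¬¬-excluded-middle)
open import Relation.Binary.PropositionalEquality
  using (_≡_; _≢_; refl; sym; trans; cong; subst; subst₂; module ≡-Reasoning)

private
  variable
    n : ℕ

InjectivePlacement : Placement n → Set
InjectivePlacement τ = Injective _≡_ _≡_ τ

swapAt-fst : ∀ (τ : Placement n) a b → swapAt τ a b a ≡ τ b
swapAt-fst τ a b with a ≟ a
... | yes _  = refl
... | no a≢a = ⊥-elim (a≢a refl)

swapAt-snd : ∀ (τ : Placement n) a b → b ≢ a → swapAt τ a b b ≡ τ a
swapAt-snd τ a b b≢a with b ≟ a
... | yes b≡a = ⊥-elim (b≢a b≡a)
... | no _ with b ≟ b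
...   | yes _  = refl
...   | no b≢b = ⊥-elim (b≢b refl)

swapAt-other : ∀ (τ : Placement n) a b x → x ≢ a → x ≢ b → swapAt τ a b x ≡ τ x
swapAt-other τ a b x x≢a x≢b with x ≟ a
... | yes x≡a = ⊥-elim (x≢a x≡a)
... | no _ with x ≟ b
...   | yes x≡b = ⊥-elim (x≢b x≡b)
...   | no _    = refl

swapAt-transpose : ∀ (τ : Placement n) a b x → swapAt τ a b x ≡ τ (transpose a b x)
swapAt-transpose τ a b x with x ≟ a
... | yes _ = refl
... | no _ with x ≟ b
...   | yes _ = refl
...   | no _  = refl

swapAt-injective : ∀ {τ : Placement n} a b → InjectivePlacement τ → InjectivePlacement (swapAt τ a b)
swapAt-injective {τ = τ} a b τ-inj {x} {y} eq = begin
  x                                   ≡⟨ sym (transpose-inverse b a) ⟩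
  transpose b a (transpose a b x)     ≡⟨ cong (transpose b a) (τ-inj τ-eq) ⟩
  transpose b a (transpose a b y)     ≡⟨ transpose-inverse b a ⟩
  y                                   ∎
  where
  open ≡-Reasoning
  τ-eq : τ (transpose a b x) ≡ τ (transpose a b y)
  τ-eq = trans (sym (swapAt-transpose τ a b x)) (trans eq (swapAt-transpose τ a b y))

involved-token-moves-along-edge : ∀ (G : Graph n) (τ : Placement n) {t} (s : LSwap n)
  → Adj G (fst s) (snd s) → InvolvesToken τ s t
  → ∃₂ λ x y → Adj G x y × τ x ≡ t × swapAt τ (fst s) (snd s) y ≡ t
involved-token-moves-along-edge G τ (lswap _ u v) u~v (inj₁ τu≡t) =
  u , v , u~v , τu≡t , trans (swapAt-snd τ u v (λ v≡u → irrefl G (subst (Adj G u) v≡u u~v))) τu≡t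
involved-token-moves-along-edge G τ (lswap _ u v) u~v (inj₂ τv≡t) =
  v , u , Graph.sym G u~v , τv≡t , trans (swapAt-fst τ u v) τv≡t

applyLSwap : Placement n → LSwap n → Placement n
applyLSwap τ s = swapAt τ (fst s) (snd s)

applyLSwaps-injective : ∀ {τ : Placement n} ss → InjectivePlacement τ → InjectivePlacement (applyLSwaps τ ss)
applyLSwaps-injective []       τ-inj = τ-inj
applyLSwaps-injective (s ∷ ss) τ-inj = applyLSwaps-injective ss (swapAt-injective (fst s) (snd s) τ-inj)

before-injective : ∀ {τ : Placement n} ss m → InjectivePlacement τ → InjectivePlacement (before τ ss m)
before-injective ss m = applyLSwaps-injective (take m ss)

before-suc : ∀ (τ : Placement n) ss (m : Fin (length ss))
  → before τ ss (suc (toℕ m)) ≡ applyLSwap (before τ ss (toℕ m)) (lookup ss m)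
before-suc τ (s ∷ ss) Fin.zero    = refl
before-suc τ (s ∷ ss) (Fin.suc m) = before-suc (applyLSwap τ s) ss m

swap-fixes-uninvolved-token : ∀ (τ : Placement n) s {t w}
  → ¬ InvolvesToken τ s t → τ w ≡ t → applyLSwap τ s w ≡ t
swap-fixes-uninvolved-token τ s {w = w} not-involved τw≡t =
  trans (swapAt-other τ (fst s) (snd s) w w≢fst w≢snd) τw≡t
  where
  w≢fst : w ≢ fst s
  w≢fst refl = not-involved (inj₁ τw≡t)
  w≢snd : w ≢ snd s
  w≢snd refl = not-involved (inj₂ τw≡t)

untouched-token-stays : ∀ (τ : Placement n) ss {t w m₀ m₁} → before τ ss m₀ w ≡ t
  → (∀ (m : Fin (length ss)) → m₀ ≤ toℕ m → toℕ m < m₁ → ¬ InvolvesToken (before τ ss (toℕ m)) (lookup ss m) t)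
  → m₀ ≤′ m₁ → m₁ ≤ length ss → before τ ss m₁ w ≡ t
untouched-token-stays τ ss at-w untouched ≤′-refl _ = at-w
untouched-token-stays τ ss {t} {w} {m₀} {suc m₁} at-w untouched (≤′-step m₀≤′m₁) m₁<len =
  subst (λ k → before τ ss (suc k) w ≡ t) (toℕ-fromℕ< m₁<len) (begin
    before τ ss (suc (toℕ m)) w              ≡⟨ cong (λ σ → σ w) (before-suc τ ss m) ⟩
    applyLSwap (before τ ss (toℕ m)) (lookup ss m) w
      ≡⟨ swap-fixes-uninvolved-token (before τ ss (toℕ m)) (lookup ss m) m-untouched at-w-before-m ⟩
    t                                        ∎)
  where
  open ≡-Reasoning
  m : Fin (length ss)
  m = fromℕ< m₁<len
  m₀≤m : m₀ ≤ toℕ m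
  m₀≤m = subst (m₀ ≤_) (sym (toℕ-fromℕ< m₁<len)) (≤′⇒≤ m₀≤′m₁)
  m-untouched : ¬ InvolvesToken (before τ ss (toℕ m)) (lookup ss m) t
  m-untouched = untouched m m₀≤m (subst (_< suc m₁) (sym (toℕ-fromℕ< m₁<len)) ≤-refl)
  at-w-before-m : before τ ss (toℕ m) w ≡ t
  at-w-before-m = subst (λ k → before τ ss k w ≡ t) (sym (toℕ-fromℕ< m₁<len))
    (untouched-token-stays τ ss at-w (λ k p q → untouched k p (m<n⇒m<1+n q))
      m₀≤′m₁ (<⇒≤ m₁<len))

happy-swaps-of-chain : List (Fin n × Fin n) → List (LSwap n)
happy-swaps-of-chain = map (λ e → lswap happy (proj₁ e) (proj₂ e))

applyLSwaps-happy-swaps-of-chain : ∀ (τ : Placement n) es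
  → applyLSwaps τ (happy-swaps-of-chain es) ≡ applyEdges τ es
applyLSwaps-happy-swaps-of-chain τ []       = refl
applyLSwaps-happy-swaps-of-chain τ (e ∷ es) = applyLSwaps-happy-swaps-of-chain (swapAt τ (proj₁ e) (proj₂ e)) es

happy-swaps-of-chain-happy : (es : List (Fin n × Fin n)) → All ((_≡ happy) ∘ kind) (happy-swaps-of-chain es)
happy-swaps-of-chain-happy []       = []
happy-swaps-of-chain-happy (e ∷ es) = refl ∷ happy-swaps-of-chain-happy es

unhappy-lookup-skips-happy-prefix : ∀ (τ : Placement n) xs ys → All ((_≡ happy) ∘ kind) xs
  → (k : Fin (length (xs ++ ys))) → kind (lookup (xs ++ ys) k) ≡ unhappy
  → Σ[ k′ ∈ Fin (length ys) ] lookup (xs ++ ys) k ≡ lookup ys k′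
                              × before τ (xs ++ ys) (toℕ k) ≡ before (applyLSwaps τ xs) ys (toℕ k′)
unhappy-lookup-skips-happy-prefix τ []       ys _           k           _  = k , refl , refl
unhappy-lookup-skips-happy-prefix τ (x ∷ xs) ys (refl ∷ _)  Fin.zero    ()
unhappy-lookup-skips-happy-prefix τ (x ∷ xs) ys (_ ∷ xs-happy) (Fin.suc k) eq =
  unhappy-lookup-skips-happy-prefix (applyLSwap τ x) xs ys xs-happy k eq

valid-unhappy-swap : ∀ (G : Graph n) σ ops → ValidSeq G σ ops
  → (k : Fin (length (flatten ops))) → kind (lookup (flatten ops) k) ≡ unhappy
  → let s = lookup (flatten ops) k in UnhappySwap G (before σ (flatten ops) (toℕ k)) (fst s) (snd s)
valid-unhappy-swap G σ (unhappy u v ∷ ops) (valid , _) Fin.zero _ = valid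
valid-unhappy-swap G σ (unhappy u v ∷ ops) (_ , valid) (Fin.suc k) eq =
  valid-unhappy-swap G (swapAt σ u v) ops valid k eq
valid-unhappy-swap G σ (chain p ∷ ops) (_ , valid) k eq
  with unhappy-lookup-skips-happy-prefix σ (happy-swaps-of-chain (edgesOf p)) (flatten ops)
         (happy-swaps-of-chain-happy (edgesOf p)) k eq
... | k′ , same-swap , same-placement =
  subst₂ (λ s τ → UnhappySwap G τ (fst s) (snd s)) (sym same-swap)
    (sym (trans same-placement
      (cong (λ τ → before τ (flatten ops) (toℕ k′)) (applyLSwaps-happy-swaps-of-chain σ (edgesOf p)))))
    (valid-unhappy-swap G (applyEdges σ (edgesOf p)) ops valid k′ (trans (cong kind (sym same-swap)) eq))

walk-zero : ∀ {G : Graph n} {x y} → Walk G x y 0 → x ≡ y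
walk-zero here = refl

walk-one : ∀ {G : Graph n} {x y} → Walk G x y 1 → Adj G x y
walk-one (step x~y here) = x~y

dist-adjacent : ∀ {G : Graph n} {x y} → Adj G x y → Dist G x y 1
dist-adjacent {G = G} {y = y} x~y = step x~y here , shortest
  where
  shortest : ∀ k → Walk G _ y k → 1 ≤ k
  shortest zero    walk = ⊥-elim (irrefl G (subst (λ z → Adj G z y) (walk-zero walk) x~y))
  shortest (suc k) _    = s≤s z≤n

dist-two : ∀ {G : Graph n} {x w y} → x ≢ y → ¬ Adj G x y → Adj G x w → Adj G w y → Dist G x y 2
dist-two {G = G} {x} {y = y} x≢y x≁y x~w w~y = step x~w (step w~y here) , shortest
  where
  shortest : ∀ k → Walk G x y k → 2 ≤ k
  shortest zero          walk = ⊥-elim (x≢y (walk-zero walk))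
  shortest (suc zero)    walk = ⊥-elim (x≁y (walk-one walk))
  shortest (suc (suc k)) _    = s≤s (s≤s z≤n)

-- The neighbour a of w is at distance 1 or 2 from t; either way the distance does not drop by one.
reducesByOne-from-neighbour⇒target : ∀ {G : Graph n} {t w a}
  → Adj G w t → Adj G w a → ReducesByOne G t w a → a ≡ t
reducesByOne-from-neighbour⇒target {G = G} {t} {w} {a} w~t w~a reduces with a ≟ t
... | yes a≡t = a≡t
... | no  a≢t = ⊥-elim (¬¬-excluded-middle λ
  { (yes a~t) → not-one   (reduces 1 1 (dist-adjacent w~t) (dist-adjacent a~t))
  ; (no  a≁t) → not-two   (reduces 1 2 (dist-adjacent w~t) (dist-two a≢t a≁t (Graph.sym G w~a) w~t)) })
  where
  not-one : ¬ 1 ≡ 2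
  not-one ()
  not-two : ¬ 1 ≡ 3
  not-two ()

module TokenNextToTarget {G : Graph n} {τ : Placement n} (τ-inj : InjectivePlacement τ)
                  {t w : Fin n} (τw≡t : τ w ≡ t) (w~t : Adj G w t) where

  not-on-target : ∀ {a} → OnTarget τ a → τ a ≢ t
  not-on-target {a} τa≡a τa≡t = irrefl G (subst (λ z → Adj G z t) w≡t w~t)
    where
    a≡t : a ≡ t
    a≡t = trans (sym τa≡a) τa≡t
    w≡t : w ≡ t
    w≡t = τ-inj (trans τw≡t (sym (subst (λ z → τ z ≡ t) a≡t τa≡t)))

  not-approaching : ∀ {a b} → Adj G a b → OnTarget τ a → ReducesByOne G (τ b) b a → τ b ≢ t
  not-approaching {a} {b} a~b τa≡a reduces τb≡t = not-on-target τa≡a (trans τa≡a a≡t)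
    where
    b≡w : b ≡ w
    b≡w = τ-inj (trans τb≡t (sym τw≡t))
    a≡t : a ≡ t
    a≡t = reducesByOne-from-neighbour⇒target w~t (subst (λ z → Adj G z a) b≡w (Graph.sym G a~b))
            (subst₂ (λ s z → ReducesByOne G s z a) τb≡t b≡w reduces)

  unhappy-swap-avoids : ∀ {a b} → UnhappySwap G τ a b → ¬ (τ a ≡ t ⊎ τ b ≡ t)
  unhappy-swap-avoids (_   , inj₁ (τa≡a , _))       (inj₁ τa≡t) = not-on-target τa≡a τa≡t
  unhappy-swap-avoids (a~b , inj₁ (τa≡a , reduces)) (inj₂ τb≡t) = not-approaching a~b τa≡a reduces τb≡t
  unhappy-swap-avoids (a~b , inj₂ (τb≡b , reduces)) (inj₁ τa≡t) =
    not-approaching (Graph.sym G a~b) τb≡b reduces τa≡t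
  unhappy-swap-avoids (_   , inj₂ (τb≡b , _))       (inj₂ τb≡t) = not-on-target τb≡b τb≡t

lemma3 : ∀ {n} (G : Graph n) → Connected G
       → (σ : Placement n) → Bijective _≡_ _≡_ σ
       → (ops : List (Op n)) → ValidSeq G σ ops
       → (i : Fin n) (j k : Fin (length (flatten ops)))
       → kind (lookup (flatten ops) j) ≡ unhappy
       → InvolvesToken (before σ (flatten ops) (toℕ j)) (lookup (flatten ops) j) i
       → before σ (flatten ops) (toℕ j) i ≡ i
       → toℕ j < toℕ k
       → InvolvesToken (before σ (flatten ops) (toℕ k)) (lookup (flatten ops) k) i
       → (∀ (m : Fin (length (flatten ops))) → toℕ j < toℕ m → toℕ m < toℕ k
            → ¬ InvolvesToken (before σ (flatten ops) (toℕ m)) (lookup (flatten ops) m) i)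
       → kind (lookup (flatten ops) k) ≡ happy
lemma3 {n} G _ σ (σ-inj , _) ops valid i j k j-unhappy j-involves i-home j<k k-involves untouched
  with kind (lookup (flatten ops) k) in k-kind
... | happy   = refl
... | unhappy
  with involved-token-moves-along-edge G (before σ (flatten ops) (toℕ j)) (lookup (flatten ops) j)
         (proj₁ (valid-unhappy-swap G σ ops valid j j-unhappy)) j-involves
... | x , w , x~w , x-held-i , w-receives-i =
  ⊥-elim (TokenNextToTarget.unhappy-swap-avoids (before-injective ss (toℕ k) σ-inj) w-holds-i w~i
            (valid-unhappy-swap G σ ops valid k k-kind) k-involves)
  where
  ss : List (LSwap n)
  ss = flatten ops
  x≡i : x ≡ i
  x≡i = before-injective ss (toℕ j) σ-inj (trans x-held-i (sym i-home))
  w~i : Adj G w i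
  w~i = Graph.sym G (subst (λ z → Adj G z w) x≡i x~w)
  w-holds-i : before σ ss (toℕ k) w ≡ i
  w-holds-i = untouched-token-stays σ ss (trans (cong (λ τ → τ w) (before-suc σ ss j)) w-receives-i)
                untouched (≤⇒≤′ j<k) (<⇒≤ (toℕ<n k))
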